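{- Consider an instance of the $r$-gathering problem with proximity requirement on a weighted tree, where for every user $u$ the distances $d(u,f)$, $f\in\mathcal{F}$, are pairwise distinct. Let a feasible solution be given, and suppose users $u,u'$ are assigned to facilities $f,f'$ respectively. If the $u$-$f$ path and the $u'$-$f'$ path in the tree have a common point, then $f=f'$.
   Context: A weighted tree has non-negative edge lengths and tree metric $d$ (sum of edge lengths along the unique path); paths are regarded as subsets of the tree. In the $r$-gathering problem with proximity requirement on a tree, we are given a positive integer $r$, a finite multiset $\mathcal{U}$ of users and a finite set $\mathcal{F}$ of facilities located at vertices. A feasible solution opens some facilities and assigns every user to an open facility so that (i) every open facility receives at least $r$ users, and (ii) every user is assigned to the open facility nearest to it.
   Formalization: The edge lengths of the tree are non-negative rationals instead of non-negative reals. -}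

module Defs where

open import Data.Nat using (ℕ; _≥_; _>_)
open import Data.Fin using (Fin)
open import Data.Fin.Properties using () renaming (_≟_ to _≟ᶠ_)
open import Data.Fin.Subset using (Subset; _∈_; _⊆_)
open import Data.List using (List; []; _∷_; length; filter; allFin)
open import Data.List.Relation.Unary.Unique.Propositional using (Unique)
import Data.List.Membership.Propositional as LM
open import Data.Product using (_×_; _,_; Σ; proj₁; ∃)
open import Data.Sum using (_⊎_)
open import Data.Rational using (ℚ; 0ℚ; _+_; _≤_)
open import Relation.Binary.PropositionalEquality using (_≡_; _≢_)

record WGraph : Set where
  field
    n    : ℕ
    m    : ℕ
    ends : Fin m → Fin n × Fin n
    len  : Fin m → ℚ
    len≥0 : ∀ e → 0ℚ ≤ len e

module _ (G : WGraph) where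
  open WGraph G

  Joins : Fin m → Fin n → Fin n → Set
  Joins e a c = (ends e ≡ (a , c)) ⊎ (ends e ≡ (c , a))

  data Walk : Fin n → Fin n → Set where
    nil  : ∀ {a} → Walk a a
    step : ∀ {a c b} (e : Fin m) → Joins e a c → Walk c b → Walk a b

  verts : ∀ {a b} → Walk a b → List (Fin n)
  verts {a} nil = a ∷ []
  verts {a} (step e _ w) = a ∷ verts w

  edgs : ∀ {a b} → Walk a b → List (Fin m)
  edgs nil = []
  edgs (step e _ w) = e ∷ edgs w

  wlen : ∀ {a b} → Walk a b → ℚ
  wlen nil = 0ℚ
  wlen (step e _ w) = len e + wlen w

  IsPath : ∀ {a b} → Walk a b → Set
  IsPath w = Unique (verts w)

  Path : Fin n → Fin n → Set
  Path a b = Σ (Walk a b) IsPath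

  record IsTree : Set where
    field
      noLoop  : ∀ e → proj₁ (ends e) ≢ Data.Product.proj₂ (ends e)
      path    : (a b : Fin n) → Path a b
      unique  : ∀ {a b} (p q : Path a b) →
                  (edgs (proj₁ p) ≡ edgs (proj₁ q)) × (verts (proj₁ p) ≡ verts (proj₁ q))

record WTree : Set where
  field
    graph  : WGraph
    isTree : IsTree graph
  open WGraph graph public

  thePath : (a b : Fin n) → Walk graph a b
  thePath a b = proj₁ (IsTree.path isTree a b)

  d : Fin n → Fin n → ℚ
  d a b = wlen graph (thePath a b)

  -- the u-v path and the u'-v' path (as subsets of the tree, i.e. their
  -- vertices and the points of their edges) have a common point
  PathsMeet : Fin n → Fin n → Fin n → Fin n → Set
  PathsMeet a b a' b' =
      (∃ λ x → (x LM.∈ verts graph (thePath a b)) × (x LM.∈ verts graph (thePath a' b')))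
    ⊎ (∃ λ e → (e LM.∈ edgs graph (thePath a b)) × (e LM.∈ edgs graph (thePath a' b')))

-- r-gathering with proximity requirement.
-- Users: a multiset given as k users, user i located at vertex loc i.
-- Facilities: a set F of vertices.

record Instance (T : WTree) : Set where
  open WTree T
  field
    r   : ℕ
    r>0 : r > 0
    k   : ℕ
    loc : Fin k → Fin n
    F   : Subset n

module _ {T : WTree} (I : Instance T) where
  open WTree T
  open Instance I

  load : (Fin k → Fin n) → Fin n → ℕ
  load σ f = length (filter (λ i → σ i ≟ᶠ f) (allFin k))

  record Feasible : Set where
    field
      opened    : Subset n
      opened⊆F  : opened ⊆ F
      assign    : Fin k → Fin n
      assignOpen : ∀ i → assign i ∈ opened
      enough    : ∀ f → f ∈ opened → load assign f ≥ r
      nearest   : ∀ i g → g ∈ opened → d (loc i) (assign i) ≤ d (loc i) g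

  DistinctDistances : Set
  DistinctDistances = ∀ i f g → f ∈ F → g ∈ F → f ≢ g → d (loc i) f ≢ d (loc i) g

module Submission where

-- Suppose user u is assigned to f, user u' to f', f ≠ f', and the u–f and
-- u'–f' paths share a point; an edge shared by the two paths contributes its
-- endpoint, so we may take a common vertex x.  Because the assignment is to a
-- nearest facility and distances are distinct, d(u,f) < d(u,f').  As x lies on
-- the u–f path, d(u,x) + d(x,f) ≤ d(u,f) < d(u,f') ≤ d(u,x) + d(x,f'), hence
-- d(x,f) < d(x,f').  Symmetrically d(x,f') < d(x,f), a contradiction.

open import Defs
open import Data.Fin using (Fin)
open import Data.Fin.Properties using () renaming (_≟_ to _≟ᶠ_)
open import Data.Fin.Subset using (_∈_)
open import Data.List using (List; []; _∷_)
open import Data.List.Relation.Unary.Any using (here; there)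
open import Data.List.Relation.Unary.All using () renaming ([] to []ᴬ)
open import Data.List.Relation.Unary.All.Properties using (¬Any⇒All¬)
open import Data.List.Relation.Unary.Unique.Propositional using (_∷_; [])
import Data.List.Membership.Propositional as LM
open import Data.Product using (_×_; _,_; Σ; proj₁; proj₂; ∃)
open import Data.Sum using (inj₁; inj₂)
open import Data.Empty using (⊥-elim)
open import Relation.Nullary using (yes; no)
open import Relation.Binary.Definitions using (tri<; tri≈; tri>)
open import Relation.Binary.PropositionalEquality using (_≡_; _≢_; refl; sym; trans; cong; module ≡-Reasoning)
open import Data.Rational using (ℚ; 0ℚ; _+_; _≤_; _<_)
import Data.Rational.Properties as ℚP

≤∧≢⇒< : ∀ {p q : ℚ} → p ≤ q → p ≢ q → p < q
≤∧≢⇒< {p} {q} p≤q p≢q with ℚP.<-cmp p q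
... | tri< p<q _ _ = p<q
... | tri≈ _ p≡q _ = ⊥-elim (p≢q p≡q)
... | tri> _ _ q<p = ⊥-elim (ℚP.<-irrefl refl (ℚP.<-≤-trans q<p p≤q))

+-cancelˡ-< : ∀ (r : ℚ) {p q : ℚ} → r + p < r + q → p < q
+-cancelˡ-< r {p} {q} r+p<r+q with ℚP.<-cmp p q
... | tri< p<q _ _ = p<q
... | tri≈ _ refl _ = ⊥-elim (ℚP.<-irrefl refl r+p<r+q)
... | tri> _ _ q<p =
  ⊥-elim (ℚP.<-asym r+p<r+q (ℚP.+-monoʳ-< r q<p))

≤-+-nonNegˡ : ∀ {p : ℚ} (q : ℚ) → 0ℚ ≤ p → q ≤ p + q
≤-+-nonNegˡ {p} q 0≤p = begin
  q       ≡⟨ sym (ℚP.+-identityˡ q) ⟩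
  0ℚ + q  ≤⟨ ℚP.+-monoˡ-≤ q 0≤p ⟩
  p + q   ∎
  where open ℚP.≤-Reasoning

module Walks (G : WGraph) where
  open WGraph G
  open import Data.List.Membership.DecPropositional (_≟ᶠ_ {n}) using (_∈?_)

  -- Total length of a list of edges; the length of a walk depends only on
  -- its edge list, which is what the uniqueness of tree paths controls.
  edgeLength : List (Fin m) → ℚ
  edgeLength [] = 0ℚ
  edgeLength (e ∷ es) = len e + edgeLength es

  wlen≡edgeLength : ∀ {a b} (w : Walk G a b) → wlen G w ≡ edgeLength (edgs G w)
  wlen≡edgeLength nil = refl
  wlen≡edgeLength (step e _ w) = cong (len e +_) (wlen≡edgeLength w)

  wlen-nonNeg : ∀ {a b} (w : Walk G a b) → 0ℚ ≤ wlen G w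
  wlen-nonNeg nil = ℚP.≤-refl
  wlen-nonNeg (step e _ w) =
    ℚP.≤-trans (wlen-nonNeg w) (≤-+-nonNegˡ (wlen G w) (len≥0 e))

  _++ʷ_ : ∀ {a b c} → Walk G a b → Walk G b c → Walk G a c
  nil ++ʷ v = v
  step e j w ++ʷ v = step e j (w ++ʷ v)

  wlen-++ʷ : ∀ {a b c} (w : Walk G a b) (v : Walk G b c) →
             wlen G (w ++ʷ v) ≡ wlen G w + wlen G v
  wlen-++ʷ nil v = sym (ℚP.+-identityˡ _)
  wlen-++ʷ (step e _ w) v =
    trans (cong (len e +_) (wlen-++ʷ w v)) (sym (ℚP.+-assoc (len e) _ _))

  splitAt : ∀ {a b x} (w : Walk G a b) → x LM.∈ verts G w →
            Σ (Walk G a x) λ w₁ → Σ (Walk G x b) λ w₂ →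
              (wlen G w ≡ wlen G w₁ + wlen G w₂) × (IsPath G w → IsPath G w₂)
  splitAt nil (here refl) = nil , nil , sym (ℚP.+-identityˡ _) , λ p → p
  splitAt (step e j w) (here refl) = nil , step e j w , sym (ℚP.+-identityˡ _) , λ p → p
  splitAt (step e j w) (there x∈w) with splitAt w x∈w
  ... | w₁ , w₂ , len≡ , suffixPath =
    step e j w₁ , w₂ ,
    trans (cong (len e +_) len≡) (sym (ℚP.+-assoc (len e) _ _)) ,
    λ { (_ ∷ wPath) → suffixPath wPath }

  -- Every walk can be shortcut to a path between the same ends that is no
  -- longer: if the new first vertex already occurs on the shortcut rest, jump
  -- to its occurrence, otherwise prepend the edge.
  shortcut : ∀ {a b} (w : Walk G a b) → Σ (Path G a b) λ p → wlen G (proj₁ p) ≤ wlen G w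
  shortcut nil = (nil , []ᴬ ∷ []) , ℚP.≤-refl
  shortcut {a} (step e j w) with shortcut w
  ... | (p , pPath) , p≤w with a ∈? verts G p
  ...   | no a∉p = (step e j p , ¬Any⇒All¬ (verts G p) a∉p ∷ pPath) , ℚP.+-monoʳ-≤ (len e) p≤w
  ...   | yes a∈p with splitAt p a∈p
  ...     | w₁ , w₂ , len≡ , suffixPath = (w₂ , suffixPath pPath) , w₂≤
    where
      open ℚP.≤-Reasoning
      w₂≤ : wlen G w₂ ≤ len e + wlen G w
      w₂≤ = begin
        wlen G w₂                 ≤⟨ ≤-+-nonNegˡ (wlen G w₂) (wlen-nonNeg w₁) ⟩
        wlen G w₁ + wlen G w₂     ≡⟨ sym len≡ ⟩
        wlen G p                  ≤⟨ p≤w ⟩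
        wlen G w                  ≤⟨ ≤-+-nonNegˡ (wlen G w) (len≥0 e) ⟩
        len e + wlen G w          ∎

  start∈verts : ∀ {a b} (w : Walk G a b) → a LM.∈ verts G w
  start∈verts nil = here refl
  start∈verts (step _ _ _) = here refl

  endpoint∈verts : ∀ {a b e} (w : Walk G a b) → e LM.∈ edgs G w →
                   proj₁ (ends e) LM.∈ verts G w
  endpoint∈verts (step e (inj₁ ends≡) w) (here refl) rewrite ends≡ = here refl
  endpoint∈verts (step e (inj₂ ends≡) w) (here refl) rewrite ends≡ = there (start∈verts w)
  endpoint∈verts (step _ _ w) (there e∈w) = there (endpoint∈verts w e∈w)

module TreeMetric (T : WTree) where
  open WTree T
  open Walks graph

  -- Every path realises the tree distance, since it has the same edges as
  -- the chosen path.
  d≡path : ∀ {a b} (p : Path graph a b) → d a b ≡ wlen graph (proj₁ p)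
  d≡path {a} {b} p = begin
    d a b                                       ≡⟨ wlen≡edgeLength (thePath a b) ⟩
    edgeLength (edgs graph (thePath a b))       ≡⟨ cong edgeLength sameEdges ⟩
    edgeLength (edgs graph (proj₁ p))           ≡⟨ sym (wlen≡edgeLength (proj₁ p)) ⟩
    wlen graph (proj₁ p)                        ∎
    where
      open ≡-Reasoning
      sameEdges = proj₁ (IsTree.unique isTree (IsTree.path isTree a b) p)

  d-minimal : ∀ {a b} (w : Walk graph a b) → d a b ≤ wlen graph w
  d-minimal w with shortcut w
  ... | p , p≤w = ℚP.≤-trans (ℚP.≤-reflexive (d≡path p)) p≤w

  triangle : ∀ a b c → d a c ≤ d a b + d b c
  triangle a b c = ℚP.≤-trans (d-minimal (thePath a b ++ʷ thePath b c))
                              (ℚP.≤-reflexive (wlen-++ʷ (thePath a b) (thePath b c)))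

  onPath : ∀ {a b x} → x LM.∈ verts graph (thePath a b) → d a x + d x b ≤ d a b
  onPath {a} {b} x∈ab with splitAt (thePath a b) x∈ab
  ... | w₁ , w₂ , len≡ , _ =
    ℚP.≤-trans (ℚP.+-mono-≤ (d-minimal w₁) (d-minimal w₂)) (ℚP.≤-reflexive (sym len≡))

  meetingVertex : ∀ {a b a' b'} → PathsMeet a b a' b' →
    ∃ λ x → (x LM.∈ verts graph (thePath a b)) × (x LM.∈ verts graph (thePath a' b'))
  meetingVertex (inj₁ commonVertex) = commonVertex
  meetingVertex (inj₂ (e , e∈ab , e∈a'b')) =
    proj₁ (ends e) , endpoint∈verts _ e∈ab , endpoint∈verts _ e∈a'b'

  closerFromPath : ∀ {a b c x} → x LM.∈ verts graph (thePath a b) →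
                   d a b < d a c → d x b < d x c
  closerFromPath {a} {b} {c} {x} x∈ab ab<ac = +-cancelˡ-< (d a x) (begin-strict
    d a x + d x b   ≤⟨ onPath x∈ab ⟩
    d a b           <⟨ ab<ac ⟩
    d a c           ≤⟨ triangle a x c ⟩
    d a x + d x c   ∎)
    where open ℚP.≤-Reasoning

module Gathering {T : WTree} (I : Instance T) (distinct : DistinctDistances I) (S : Feasible I) where
  open WTree T
  open Instance I
  open Feasible S

  strictlyNearest : ∀ i g → g ∈ opened → assign i ≢ g → d (loc i) (assign i) < d (loc i) g
  strictlyNearest i g g-open assign≢g = ≤∧≢⇒< (nearest i g g-open)
    (distinct i (assign i) g (opened⊆F (assignOpen i)) (opened⊆F g-open) assign≢g)

mainTheorem8 : (T : WTree) (I : Instance T) → DistinctDistances I →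
    (S : Feasible I) (i j : Fin (Instance.k I)) →
    WTree.PathsMeet T (Instance.loc I i) (Feasible.assign S i)
    (Instance.loc I j) (Feasible.assign S j) →
    Feasible.assign S i ≡ Feasible.assign S j
mainTheorem8 T I distinct S i j meet with Feasible.assign S i ≟ᶠ Feasible.assign S j
... | yes same = same
... | no differ = ⊥-elim (ℚP.<-asym closerToFᵢ closerToFⱼ)
  where
    open TreeMetric T
    open Feasible S
    open WTree T using (d)
    open Gathering I distinct S

    x : Fin (WTree.n T)
    x = proj₁ (meetingVertex meet)

    closerToFᵢ : d x (assign i) < d x (assign j)
    closerToFᵢ = closerFromPath (proj₁ (proj₂ (meetingVertex meet)))
                   (strictlyNearest i (assign j) (assignOpen j) differ)
    closerToFⱼ : d x (assign j) < d x (assign i)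
    closerToFⱼ = closerFromPath (proj₂ (proj₂ (meetingVertex meet)))
                   (strictlyNearest j (assign i) (assignOpen i) (λ eq → differ (sym eq)))
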